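{- Let $G=(V,E)$ be a finite simple graph and let $u\in V$. Then \[ D(G,x) = x\,D(G/u,x) + D(G-u,x) + x\,D(G-N[u],x) - (1+x)\,p_u(G,x). \] Furthermore, \[ D_{u\notin W}(G,x) = D(G-u,x) - p_u(G,x),\qquad D_{u\in W}(G,x) = x\,D(G-N[u],x) + x\big(D(G/u,x) - p_u(G,x)\big). \]
   Context: For a finite simple graph $G=(V,E)$ and $W\subseteq V$, $N_G[W]$ is the closed neighborhood of $W$, and $N_G(u)$, $N_G[u]$ are the open and closed neighborhoods of a vertex $u$. $W$ is a dominating set of $G$ if $N_G[W]=V$. The domination polynomial is $D(G,x)=\sum_{W\subseteq V,\ N_G[W]=V} x^{|W|}$; in particular the graph with no vertices has $D=1$. $D_{u\in W}(G,x)$ (resp. $D_{u\notin W}(G,x)$) is the sum of $x^{|W|}$ over dominating sets $W$ of $G$ with $u\in W$ (resp. $u\notin W$). $p_u(G,x)$ is the sum of $x^{|W|}$ over all dominating sets $W$ of $G-u$ that contain no vertex of $N_G(u)$. Graph operations: - $G-u$ deletes $u$ and its incident edges. - $G/u$ deletes $u$ and adds an edge between every pair of non-adjacent neighbors of $u$. - $G-N[u]$ deletes all vertices of $N_G[u]$. -}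

module Defs where

open import Level using (Level)
open import Data.Bool using (Bool; true; false; _∧_; _∨_; not; if_then_else_)
open import Data.Nat using (ℕ; zero; suc)
open import Data.Fin using (Fin; _≟_)
open import Data.Vec using (Vec; []; _∷_; lookup; tabulate)
open import Data.List using (List; []; _∷_; _++_; map; allFin; foldr)
open import Data.Bool.ListAction using (all; any)
open import Data.Product using (_×_)
open import Relation.Nullary.Decidable using (⌊_⌋)
open import Relation.Binary.PropositionalEquality using (_≡_)
open import Algebra.Bundles using (CommutativeRing)

Sub : ℕ → Set
Sub n = Vec Bool n

allSubs : ∀ n → List (Sub n)
allSubs zero = [] ∷ []
allSubs (suc n) = map (false ∷_) (allSubs n) ++ map (true ∷_) (allSubs n)

size : ∀ {n} → Sub n → ℕ
size [] = 0
size (false ∷ W) = size W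
size (true ∷ W) = suc (size W)

record Graph (n : ℕ) : Set where
  constructor mkGraph
  field
    V   : Sub n
    adj : Fin n → Fin n → Bool
open Graph public

record IsSimple {n : ℕ} (G : Graph n) : Set where
  field
    adj-sym    : ∀ i j → adj G i j ≡ adj G j i
    adj-irrefl : ∀ i → adj G i i ≡ false
    adj-V      : ∀ i j → adj G i j ≡ true → (lookup (V G) i ≡ true) × (lookup (V G) j ≡ true)

_==_ : ∀ {n} → Fin n → Fin n → Bool
i == j = ⌊ i ≟ j ⌋

deleteSet : ∀ {n} → Graph n → Sub n → Graph n
deleteSet G S = mkGraph
  (tabulate (λ i → lookup (V G) i ∧ not (lookup S i)))
  (λ i j → adj G i j ∧ not (lookup S i) ∧ not (lookup S j))

deleteV : ∀ {n} → Graph n → Fin n → Graph n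
deleteV G u = deleteSet G (tabulate (λ i → i == u))

deleteN : ∀ {n} → Graph n → Fin n → Graph n
deleteN G u = deleteSet G (tabulate (λ i → (i == u) ∨ adj G u i))

contract : ∀ {n} → Graph n → Fin n → Graph n
contract G u = mkGraph
  (tabulate (λ i → lookup (V G) i ∧ not (i == u)))
  (λ i j → (adj G i j ∨ (adj G u i ∧ adj G u j ∧ not (i == j)))
           ∧ not (i == u) ∧ not (j == u))

isDom : ∀ {n} → Graph n → Sub n → Bool
isDom {n} G W =
  all (λ w → not (lookup W w) ∨ lookup (V G) w) (allFin n)
  ∧ all (λ v → not (lookup (V G) v) ∨ lookup W v
                 ∨ any (λ w → lookup W w ∧ adj G w v) (allFin n))
        (allFin n)

avoidsN : ∀ {n} → Graph n → Fin n → Sub n → Bool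
avoidsN {n} G u W = all (λ w → not (lookup W w ∧ adj G u w)) (allFin n)

module _ {c ℓ : Level} (R : CommutativeRing c ℓ) where
  open CommutativeRing R

  pow : Carrier → ℕ → Carrier
  pow x zero = 1#
  pow x (suc k) = x * pow x k

  sumSubs : ∀ {n} → (Sub n → Bool) → Carrier → Carrier
  sumSubs {n} P x =
    foldr (λ W acc → if P W then pow x (size W) + acc else acc) 0# (allSubs n)

  D : ∀ {n} → Graph n → Carrier → Carrier
  D G x = sumSubs (isDom G) x

  Din : ∀ {n} → Graph n → Fin n → Carrier → Carrier
  Din G u x = sumSubs (λ W → isDom G W ∧ lookup W u) x

  Dout : ∀ {n} → Graph n → Fin n → Carrier → Carrier
  Dout G u x = sumSubs (λ W → isDom G W ∧ not (lookup W u)) x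

  p : ∀ {n} → Graph n → Fin n → Carrier → Carrier
  p G u x = sumSubs (λ W → isDom (deleteV G u) W ∧ avoidsN G u W) x

module Submission where

-- Split the dominating sets W of G according to whether u ∈ W.
--  * u ∉ W: W dominates G iff W dominates G - u and meets N(u), so
--    D_{u∉W}(G) = D(G-u) - p_u(G), p_u counting the sets of G - u avoiding N(u).
--  * u ∈ W: write W = W' ∪ {u} with u ∉ W'.  If W' avoids N(u), then W
--    dominates G iff W' dominates G - N[u]; if W' meets N(u), iff W' dominates
--    G / u.  The dominating sets of G / u avoiding N(u) are exactly those of
--    G - u avoiding N(u), so the second kind contributes D(G/u) - p_u(G).

open import Defs
open import Level using (Level)
open import Algebra.Bundles using (CommutativeRing)
open import Data.Bool using (Bool; true; false; T; _∧_; _∨_; not; if_then_else_)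
open import Data.Bool.Properties using (T-∧; T-∨; T-≡; ∧-zeroʳ)
open import Data.Bool.ListAction using (all; any)
open import Data.Empty using (⊥-elim)
open import Data.Fin using (Fin; zero; suc; _≟_)
open import Data.List using (List; []; _∷_; _++_; map; allFin; foldr)
open import Data.List.Properties using (foldr-++; foldr-map)
open import Data.List.Membership.Propositional.Properties using (∈-allFin)
import Data.List.Relation.Unary.All as All
open import Data.List.Relation.Unary.All.Properties using (all⁺; all⁻; ¬All⇒Any¬)
import Data.List.Relation.Unary.Any as Any
open import Data.List.Relation.Unary.Any.Properties using (any⁺; any⁻)
open import Data.Nat using (ℕ; suc)
open import Data.Product using (_×_; _,_; proj₁; proj₂; ∃-syntax)
open import Data.Sum using (_⊎_; inj₁; inj₂)
open import Data.Unit using (tt)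
open import Data.Vec using ([]; _∷_; lookup; tabulate; _[_]≔_)
open import Data.Vec.Properties using (lookup∘tabulate; lookup∘update; lookup∘update′)
open import Function.Bundles using (mk⇔; Equivalence)
open import Relation.Nullary using (¬_; yes; no)
open import Relation.Nullary.Decidable using (does-⇔; T?; toWitness; fromWitness; toWitnessFalse; fromWitnessFalse)
open import Relation.Binary.PropositionalEquality using (_≡_; _≢_; refl; sym; trans; cong; cong₂; subst)

infix 4 _∋_

_∋_ : ∀ {n} → Sub n → Fin n → Set
W ∋ i = T (lookup W i)

Adj : ∀ {n} → Graph n → Fin n → Fin n → Set
Adj G i j = T (adj G i j)

T-ext : ∀ {a b} → (T a → T b) → (T b → T a) → a ≡ b
T-ext {a} {b} f g = does-⇔ (mk⇔ f g) (T? a) (T? b)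

T-not⁺ : ∀ b → ¬ T b → T (not b)
T-not⁺ true ¬b = ¬b tt
T-not⁺ false _ = tt

T-not⁻ : ∀ b → T (not b) → ¬ T b
T-not⁻ true () _
T-not⁻ false _ ()

T-¬not : ∀ b → ¬ T (not b) → T b
T-¬not true _ = tt
T-¬not false ¬t = ¬t tt

T-⇒⁻ : ∀ a {b} → T (not a ∨ b) → T a → T b
T-⇒⁻ true t _ = t

T-⇒⁺ : ∀ a {b} → (T a → T b) → T (not a ∨ b)
T-⇒⁺ true f = f tt
T-⇒⁺ false _ = tt

T-∧-not⁻ : ∀ a b → T (a ∧ not b) → T a × ¬ T b
T-∧-not⁻ a b t = let ta , tb = Equivalence.to (T-∧ {a}) t in ta , T-not⁻ b tb

T-∧-not⁺ : ∀ a b → T a → ¬ T b → T (a ∧ not b)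
T-∧-not⁺ a b ta ¬tb = Equivalence.from (T-∧ {a}) (ta , T-not⁺ b ¬tb)

∧-guard : ∀ {a b} c → (T c → a ≡ b) → a ∧ c ≡ b ∧ c
∧-guard {a} {b} true eq = cong (_∧ true) (eq tt)
∧-guard {a} {b} false _ = trans (∧-zeroʳ a) (sym (∧-zeroʳ b))

all-allFin⁻ : ∀ {n} (p : Fin n → Bool) → T (all p (allFin n)) → ∀ i → T (p i)
all-allFin⁻ p t i = All.lookup (all⁺ p (allFin _) t) (∈-allFin i)

all-allFin⁺ : ∀ {n} (p : Fin n → Bool) → (∀ i → T (p i)) → T (all p (allFin n))
all-allFin⁺ p h = all⁻ p {allFin _} (All.tabulate (λ {i} _ → h i))

any-allFin⁻ : ∀ {n} (p : Fin n → Bool) → T (any p (allFin n)) → ∃[ i ] T (p i)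
any-allFin⁻ p t = Any.satisfied (any⁻ p (allFin _) t)

any-allFin⁺ : ∀ {n} (p : Fin n → Bool) {i} → T (p i) → T (any p (allFin n))
any-allFin⁺ p {i} t = any⁺ p (Any.map {P = i ≡_} {Q = λ j → T (p j)} (λ { refl → t }) (∈-allFin i))

¬all-allFin : ∀ {n} (p : Fin n → Bool) → ¬ T (all p (allFin n)) → ∃[ i ] ¬ T (p i)
¬all-allFin p ¬t = Any.satisfied (¬All⇒Any¬ (λ i → T? (p i)) (allFin _) (λ ps → ¬t (all⁻ p ps)))

data DominatedBy {n} (G : Graph n) (W : Sub n) (v : Fin n) : Set where
  member    : W ∋ v → DominatedBy G W v
  neighbour : ∀ w → W ∋ w → Adj G w v → DominatedBy G W v

record Dominating {n} (G : Graph n) (W : Sub n) : Set where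
  constructor dominating
  field
    inside    : ∀ {w} → W ∋ w → V G ∋ w
    dominates : ∀ {v} → V G ∋ v → DominatedBy G W v

isDom⁻ : ∀ {n} (G : Graph n) W → T (isDom G W) → Dominating G W
isDom⁻ {n} G W t = dominating inside dominates
  where
  inW⇒inV covered : Fin n → Bool
  inW⇒inV w = not (lookup W w) ∨ lookup (V G) w
  covered v = not (lookup (V G) v) ∨ lookup W v ∨ any (λ w → lookup W w ∧ adj G w v) (allFin n)
  parts : T (all inW⇒inV (allFin n)) × T (all covered (allFin n))
  parts = Equivalence.to (T-∧ {all inW⇒inV (allFin n)}) t
  inside : ∀ {w} → W ∋ w → V G ∋ w
  inside {w} = T-⇒⁻ (lookup W w) (all-allFin⁻ inW⇒inV (proj₁ parts) w)
  dominates : ∀ {v} → V G ∋ v → DominatedBy G W v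
  dominates {v} v∈V with Equivalence.to (T-∨ {lookup W v}) (T-⇒⁻ (lookup (V G) v) (all-allFin⁻ covered (proj₂ parts) v) v∈V)
  ... | inj₁ v∈W = member v∈W
  ... | inj₂ t′ = let w , wv = any-allFin⁻ _ t′
                      w∈W , a = Equivalence.to (T-∧ {lookup W w}) wv
                  in neighbour w w∈W a

isDom⁺ : ∀ {n} (G : Graph n) W → Dominating G W → T (isDom G W)
isDom⁺ G W (dominating inside dominates) =
  Equivalence.from T-∧ ( all-allFin⁺ _ (λ w → T-⇒⁺ (lookup W w) inside)
                       , all-allFin⁺ _ (λ v → T-⇒⁺ (lookup (V G) v) (λ v∈V → witness (dominates v∈V))))
  where
  witness : ∀ {v} → DominatedBy G W v → T (lookup W v ∨ any (λ w → lookup W w ∧ adj G w v) (allFin _))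
  witness (member v∈W) = Equivalence.from T-∨ (inj₁ v∈W)
  witness {v} (neighbour w w∈W a) = Equivalence.from (T-∨ {lookup W v})
    (inj₂ (any-allFin⁺ (λ w → lookup W w ∧ adj G w v) (Equivalence.from (T-∧ {lookup W w}) (w∈W , a))))

dominatedBy-mono : ∀ {n} {G H : Graph n} {W W′ : Sub n} {v} →
  (∀ {i} → W ∋ i → W′ ∋ i) → (∀ {w} → W ∋ w → Adj G w v → Adj H w v) →
  DominatedBy G W v → DominatedBy H W′ v
dominatedBy-mono ⊆ edges (member v∈W) = member (⊆ v∈W)
dominatedBy-mono ⊆ edges (neighbour w w∈W a) = neighbour w (⊆ w∈W) (edges w∈W a)

dominating-transfer : ∀ {n} {G H : Graph n} {W : Sub n} →
  (∀ {i} → V G ∋ i → V H ∋ i) → (∀ {i} → V H ∋ i → V G ∋ i) →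
  (∀ {w v} → W ∋ w → Adj G w v → Adj H w v) → Dominating G W → Dominating H W
dominating-transfer G⊆H H⊆G edges (dominating inside dominates) =
  dominating (λ w∈W → G⊆H (inside w∈W))
             (λ v∈V → dominatedBy-mono (λ i∈W → i∈W) edges (dominates (H⊆G v∈V)))

Avoids : ∀ {n} → Graph n → Fin n → Sub n → Set
Avoids G u W = ∀ {w} → W ∋ w → ¬ Adj G u w

Meets : ∀ {n} → Graph n → Fin n → Sub n → Set
Meets {n} G u W = ∃[ w ] (W ∋ w × Adj G u w)

module _ {n} (G : Graph n) (u : Fin n) (W : Sub n) where
  avoidsN⁻ : T (avoidsN G u W) → Avoids G u W
  avoidsN⁻ t {w} w∈W a = T-not⁻ _ (all-allFin⁻ _ t w) (Equivalence.from T-∧ (w∈W , a))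

  avoidsN⁺ : Avoids G u W → T (avoidsN G u W)
  avoidsN⁺ avoids = all-allFin⁺ _ λ w → T-not⁺ _ λ t →
    let w∈W , a = Equivalence.to (T-∧ {lookup W w}) t in avoids w∈W a

  meets⇒¬avoidsN : Meets G u W → ¬ T (avoidsN G u W)
  meets⇒¬avoidsN (w , w∈W , a) t = avoidsN⁻ t w∈W a

  ¬avoidsN⇒meets : ¬ T (avoidsN G u W) → Meets G u W
  ¬avoidsN⇒meets ¬t = let w , ¬q = ¬all-allFin _ ¬t in
    w , Equivalence.to (T-∧ {lookup W w}) (T-¬not _ ¬q)

tabulate-∋⁻ : ∀ {n} (f : Fin n → Bool) {i} → tabulate f ∋ i → T (f i)
tabulate-∋⁻ f {i} = subst T (lookup∘tabulate f i)

tabulate-∋⁺ : ∀ {n} (f : Fin n → Bool) {i} → T (f i) → tabulate f ∋ i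
tabulate-∋⁺ f {i} = subst T (sym (lookup∘tabulate f i))

module _ {n} (G : Graph n) (S : Sub n) where
  private
    kept : Fin n → Bool
    kept i = lookup (V G) i ∧ not (lookup S i)

  deleteSet-V⁻ : ∀ {i} → V (deleteSet G S) ∋ i → V G ∋ i × ¬ S ∋ i
  deleteSet-V⁻ t = T-∧-not⁻ _ _ (tabulate-∋⁻ kept t)

  deleteSet-V⁺ : ∀ {i} → V G ∋ i → ¬ S ∋ i → V (deleteSet G S) ∋ i
  deleteSet-V⁺ i∈V i∉S = tabulate-∋⁺ kept (T-∧-not⁺ _ _ i∈V i∉S)

  deleteSet-adj⁻ : ∀ {i j} → Adj (deleteSet G S) i j → Adj G i j × ¬ S ∋ i × ¬ S ∋ j
  deleteSet-adj⁻ {i} {j} t =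
    let a , away = Equivalence.to (T-∧ {adj G i j}) t
        i∉S , j∉S = T-∧-not⁻ (not (lookup S i)) _ away
    in a , T-not⁻ _ i∉S , j∉S

  deleteSet-adj⁺ : ∀ {i j} → Adj G i j → ¬ S ∋ i → ¬ S ∋ j → Adj (deleteSet G S) i j
  deleteSet-adj⁺ {i} a i∉S j∉S =
    Equivalence.from T-∧ (a , T-∧-not⁺ (not (lookup S i)) _ (T-not⁺ _ i∉S) j∉S)

InClosedNbhd : ∀ {n} → Graph n → Fin n → Fin n → Set
InClosedNbhd G u i = i ≡ u ⊎ Adj G u i

module _ {n} (G : Graph n) (u : Fin n) where
  private
    inU : Fin n → Bool
    inU k = k == u

    inN : Fin n → Bool
    inN k = (k == u) ∨ adj G u k

    uSet N[u] : Sub n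
    uSet = tabulate inU
    N[u] = tabulate inN

  singleton-∋⁻ : ∀ {i} → uSet ∋ i → i ≡ u
  singleton-∋⁻ t = toWitness (tabulate-∋⁻ inU t)

  singleton-∋⁺ : ∀ {i} → i ≡ u → uSet ∋ i
  singleton-∋⁺ i≡u = tabulate-∋⁺ inU (fromWitness i≡u)

  closedNbhd-∋⁻ : ∀ {i} → N[u] ∋ i → InClosedNbhd G u i
  closedNbhd-∋⁻ {i} t with Equivalence.to (T-∨ {i == u}) (tabulate-∋⁻ inN t)
  ... | inj₁ i≡u = inj₁ (toWitness i≡u)
  ... | inj₂ a = inj₂ a

  closedNbhd-∋⁺ : ∀ {i} → InClosedNbhd G u i → N[u] ∋ i
  closedNbhd-∋⁺ {i} (inj₁ i≡u) = tabulate-∋⁺ inN (Equivalence.from (T-∨ {i == u}) (inj₁ (fromWitness i≡u)))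
  closedNbhd-∋⁺ {i} (inj₂ a) = tabulate-∋⁺ inN (Equivalence.from (T-∨ {i == u}) (inj₂ a))

  deleteV-V⁻ : ∀ {i} → V (deleteV G u) ∋ i → V G ∋ i × i ≢ u
  deleteV-V⁻ t = let i∈V , i∉S = deleteSet-V⁻ G uSet t in i∈V , λ i≡u → i∉S (singleton-∋⁺ i≡u)

  deleteV-V⁺ : ∀ {i} → V G ∋ i → i ≢ u → V (deleteV G u) ∋ i
  deleteV-V⁺ i∈V i≢u = deleteSet-V⁺ G uSet i∈V (λ t → i≢u (singleton-∋⁻ t))

  deleteV-adj⁻ : ∀ {i j} → Adj (deleteV G u) i j → Adj G i j × i ≢ u × j ≢ u
  deleteV-adj⁻ t = let a , i∉S , j∉S = deleteSet-adj⁻ G uSet t in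
    a , (λ i≡u → i∉S (singleton-∋⁺ i≡u)) , (λ j≡u → j∉S (singleton-∋⁺ j≡u))

  deleteV-adj⁺ : ∀ {i j} → Adj G i j → i ≢ u → j ≢ u → Adj (deleteV G u) i j
  deleteV-adj⁺ a i≢u j≢u = deleteSet-adj⁺ G uSet a (λ t → i≢u (singleton-∋⁻ t)) (λ t → j≢u (singleton-∋⁻ t))

  deleteN-V⁻ : ∀ {i} → V (deleteN G u) ∋ i → V G ∋ i × ¬ InClosedNbhd G u i
  deleteN-V⁻ t = let i∈V , i∉S = deleteSet-V⁻ G N[u] t in i∈V , λ i∈N → i∉S (closedNbhd-∋⁺ i∈N)

  deleteN-V⁺ : ∀ {i} → V G ∋ i → ¬ InClosedNbhd G u i → V (deleteN G u) ∋ i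
  deleteN-V⁺ i∈V i∉N = deleteSet-V⁺ G N[u] i∈V (λ t → i∉N (closedNbhd-∋⁻ t))

  deleteN-adj⁻ : ∀ {i j} → Adj (deleteN G u) i j → Adj G i j
  deleteN-adj⁻ t = proj₁ (deleteSet-adj⁻ G N[u] t)

  deleteN-adj⁺ : ∀ {i j} → Adj G i j → ¬ InClosedNbhd G u i → ¬ InClosedNbhd G u j →
    Adj (deleteN G u) i j
  deleteN-adj⁺ a i∉N j∉N = deleteSet-adj⁺ G N[u] a (λ t → i∉N (closedNbhd-∋⁻ t)) (λ t → j∉N (closedNbhd-∋⁻ t))

  private
    keptC : Fin n → Bool
    keptC i = lookup (V G) i ∧ not (i == u)

  contract-V⁻ : ∀ {i} → V (contract G u) ∋ i → V G ∋ i × i ≢ u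
  contract-V⁻ t = let i∈V , ¬i==u = T-∧-not⁻ _ _ (tabulate-∋⁻ keptC t) in i∈V , λ i≡u → ¬i==u (fromWitness i≡u)

  contract-V⁺ : ∀ {i} → V G ∋ i → i ≢ u → V (contract G u) ∋ i
  contract-V⁺ i∈V i≢u = tabulate-∋⁺ keptC (T-∧-not⁺ _ _ i∈V (λ t → i≢u (toWitness t)))

  contract-adj⁻ : ∀ {i j} → Adj (contract G u) i j →
    (Adj G i j ⊎ Adj G u i × Adj G u j) × i ≢ u × j ≢ u
  contract-adj⁻ {i} {j} t =
    let e , away = Equivalence.to (T-∧ {adj G i j ∨ _}) t
        i≢u , j≢u = T-∧-not⁻ (not (i == u)) _ away
    in edge e , toWitnessFalse i≢u , (λ j≡u → j≢u (fromWitness j≡u))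
    where
    edge : T (adj G i j ∨ (adj G u i ∧ adj G u j ∧ not (i == j))) → Adj G i j ⊎ Adj G u i × Adj G u j
    edge e with Equivalence.to (T-∨ {adj G i j}) e
    ... | inj₁ a = inj₁ a
    ... | inj₂ b = let ui , rest = Equivalence.to (T-∧ {adj G u i}) b in
                   inj₂ (ui , proj₁ (Equivalence.to (T-∧ {adj G u j}) rest))

  contract-adj⁺ : ∀ {i j} → Adj G i j ⊎ Adj G u i × Adj G u j × i ≢ j → i ≢ u → j ≢ u →
    Adj (contract G u) i j
  contract-adj⁺ {i} {j} e i≢u j≢u =
    Equivalence.from T-∧ (edge e , T-∧-not⁺ (not (i == u)) _ (fromWitnessFalse i≢u) (λ t → j≢u (toWitness t)))
    where
    edge : Adj G i j ⊎ Adj G u i × Adj G u j × i ≢ j →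
      T (adj G i j ∨ (adj G u i ∧ adj G u j ∧ not (i == j)))
    edge (inj₁ a) = Equivalence.from T-∨ (inj₁ a)
    edge (inj₂ (ui , uj , i≢j)) = Equivalence.from (T-∨ {adj G i j})
      (inj₂ (Equivalence.from T-∧ (ui , T-∧-not⁺ _ _ uj (λ t → i≢j (toWitness t)))))

module _ {n} (W : Sub n) (u : Fin n) where
  insert-∋-new : (W [ u ]≔ true) ∋ u
  insert-∋-new = subst T (sym (lookup∘update u W true)) tt

  insert-∋-other : ∀ {i} → i ≢ u → (W [ u ]≔ true) ∋ i → W ∋ i
  insert-∋-other {i} i≢u = subst T (lookup∘update′ i≢u W true)

  insert-∋-old : ∀ {i} → W ∋ i → (W [ u ]≔ true) ∋ i
  insert-∋-old {i} i∈W with i ≟ u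
  ... | yes refl = insert-∋-new
  ... | no i≢u = subst T (sym (lookup∘update′ i≢u W true)) i∈W

  insert-∋⁻ : ∀ {i} → (W [ u ]≔ true) ∋ i → i ≡ u ⊎ W ∋ i
  insert-∋⁻ {i} t with i ≟ u
  ... | yes i≡u = inj₁ i≡u
  ... | no i≢u = inj₂ (insert-∋-other i≢u t)

module Correspondences {n} (G : Graph n) (u : Fin n) (u∈V : V G ∋ u) where

  insert-inside : ∀ W → (∀ {w} → W ∋ w → V G ∋ w) → ∀ {w} → (W [ u ]≔ true) ∋ w → V G ∋ w
  insert-inside W inside w∈W∪u with insert-∋⁻ W u w∈W∪u
  ... | inj₁ refl = u∈V
  ... | inj₂ w∈W = inside w∈W

  -- (1) A set W ∌ u dominates G iff it dominates G - u and meets N(u): the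
  -- neighbour of u in W is what dominates u.  Needs symmetric adjacency.
  without-u⁺ : IsSimple G → ∀ {W} → Dominating G W → ¬ W ∋ u →
    Dominating (deleteV G u) W × Meets G u W
  without-u⁺ simple {W} (dominating inside dominates) u∉W = dominating inside′ dominates′ , meets
    where
    away : ∀ {w} → W ∋ w → w ≢ u
    away w∈W refl = u∉W w∈W
    inside′ : ∀ {w} → W ∋ w → V (deleteV G u) ∋ w
    inside′ w∈W = deleteV-V⁺ G u (inside w∈W) (away w∈W)
    dominates′ : ∀ {v} → V (deleteV G u) ∋ v → DominatedBy (deleteV G u) W v
    dominates′ v∈V′ = let v∈V , v≢u = deleteV-V⁻ G u v∈V′ in
      dominatedBy-mono {W = W} (λ i∈W → i∈W) (λ w∈W a → deleteV-adj⁺ G u a (away w∈W) v≢u) (dominates v∈V)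
    meets : Meets G u W
    meets with dominates u∈V
    ... | member u∈W = ⊥-elim (u∉W u∈W)
    ... | neighbour w w∈W a = w , w∈W , subst T (IsSimple.adj-sym simple w u) a

  without-u⁻ : IsSimple G → ∀ {W} → Dominating (deleteV G u) W → Meets G u W →
    Dominating G W × ¬ W ∋ u
  without-u⁻ simple {W} (dominating inside dominates) (w₀ , w₀∈W , a₀) = dominating inside′ dominates′ , u∉W
    where
    u∉W : ¬ W ∋ u
    u∉W u∈W = proj₂ (deleteV-V⁻ G u (inside u∈W)) refl
    inside′ : ∀ {w} → W ∋ w → V G ∋ w
    inside′ w∈W = proj₁ (deleteV-V⁻ G u (inside w∈W))
    dominates′ : ∀ {v} → V G ∋ v → DominatedBy G W v
    dominates′ {v} v∈V with v ≟ u
    ... | yes refl = neighbour w₀ w₀∈W (subst T (IsSimple.adj-sym simple u w₀) a₀)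
    ... | no v≢u = dominatedBy-mono {W = W} (λ i∈W → i∈W) (λ _ a → proj₁ (deleteV-adj⁻ G u a))
                     (dominates (deleteV-V⁺ G u v∈V v≢u))

  -- (2) For W with u ∉ W and W ∩ N(u) = ∅: W ∪ {u} dominates G iff W dominates
  -- G - N[u], since u dominates exactly N[u] and nothing else reaches N(u).
  avoiding⁺ : ∀ {W} → Dominating G (W [ u ]≔ true) → ¬ W ∋ u → Avoids G u W →
    Dominating (deleteN G u) W
  avoiding⁺ {W} (dominating inside dominates) u∉W avoids = dominating inside′ dominates′
    where
    outside : ∀ {w} → W ∋ w → ¬ InClosedNbhd G u w
    outside w∈W (inj₁ refl) = u∉W w∈W
    outside w∈W (inj₂ a) = avoids w∈W a
    inside′ : ∀ {w} → W ∋ w → V (deleteN G u) ∋ w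
    inside′ w∈W = deleteN-V⁺ G u (inside (insert-∋-old W u w∈W)) (outside w∈W)
    dominates′ : ∀ {v} → V (deleteN G u) ∋ v → DominatedBy (deleteN G u) W v
    dominates′ v∈V′ with deleteN-V⁻ G u v∈V′
    ... | v∈V , v∉N with dominates v∈V
    ...   | member v∈W∪u = member (insert-∋-other W u (λ v≡u → v∉N (inj₁ v≡u)) v∈W∪u)
    ...   | neighbour w w∈W∪u a with insert-∋⁻ W u w∈W∪u
    ...     | inj₁ refl = ⊥-elim (v∉N (inj₂ a))
    ...     | inj₂ w∈W = neighbour w w∈W (deleteN-adj⁺ G u a (outside w∈W) v∉N)

  avoiding⁻ : ∀ {W} → Dominating (deleteN G u) W →
    Dominating G (W [ u ]≔ true) × ¬ W ∋ u × Avoids G u W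
  avoiding⁻ {W} (dominating inside dominates) = dominating inside′ dominates′ , u∉W , avoids
    where
    outside : ∀ {w} → W ∋ w → ¬ InClosedNbhd G u w
    outside w∈W = proj₂ (deleteN-V⁻ G u (inside w∈W))
    u∉W : ¬ W ∋ u
    u∉W u∈W = outside u∈W (inj₁ refl)
    avoids : Avoids G u W
    avoids w∈W a = outside w∈W (inj₂ a)
    inside′ : ∀ {w} → (W [ u ]≔ true) ∋ w → V G ∋ w
    inside′ = insert-inside W (λ w∈W → proj₁ (deleteN-V⁻ G u (inside w∈W)))
    dominates′ : ∀ {v} → V G ∋ v → DominatedBy G (W [ u ]≔ true) v
    dominates′ {v} v∈V with v ≟ u | T? (adj G u v)
    ... | yes refl | _ = member (insert-∋-new W u)
    ... | no _ | yes a = neighbour u (insert-∋-new W u) a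
    ... | no v≢u | no ¬a = dominatedBy-mono (insert-∋-old W u) (λ _ a → deleteN-adj⁻ G u a)
                             (dominates (deleteN-V⁺ G u v∈V λ { (inj₁ v≡u) → v≢u v≡u ; (inj₂ a) → ¬a a }))

  -- (3) For W with u ∉ W meeting N(u): W ∪ {u} dominates G iff W dominates G / u.
  -- A vertex dominated only by u is a neighbour of u, hence joined in G / u to
  -- the neighbour w₀ of u in W.
  meeting⁺ : ∀ {W} → Meets G u W → Dominating G (W [ u ]≔ true) → ¬ W ∋ u →
    Dominating (contract G u) W
  meeting⁺ {W} (w₀ , w₀∈W , a₀) (dominating inside dominates) u∉W = dominating inside′ dominates′
    where
    away : ∀ {w} → W ∋ w → w ≢ u
    away w∈W refl = u∉W w∈W
    inside′ : ∀ {w} → W ∋ w → V (contract G u) ∋ w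
    inside′ w∈W = contract-V⁺ G u (inside (insert-∋-old W u w∈W)) (away w∈W)
    dominates′ : ∀ {v} → V (contract G u) ∋ v → DominatedBy (contract G u) W v
    dominates′ {v} v∈V′ with contract-V⁻ G u v∈V′
    ... | v∈V , v≢u with dominates v∈V
    ...   | member v∈W∪u = member (insert-∋-other W u v≢u v∈W∪u)
    ...   | neighbour w w∈W∪u a with insert-∋⁻ W u w∈W∪u | v ≟ w₀
    ...     | inj₂ w∈W | _ = neighbour w w∈W (contract-adj⁺ G u (inj₁ a) (away w∈W) v≢u)
    ...     | inj₁ refl | yes refl = member w₀∈W
    ...     | inj₁ refl | no v≢w₀ =
      neighbour w₀ w₀∈W (contract-adj⁺ G u (inj₂ (a₀ , a , λ w₀≡v → v≢w₀ (sym w₀≡v))) (away w₀∈W) v≢u)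

  meeting⁻ : ∀ {W} → Dominating (contract G u) W → Dominating G (W [ u ]≔ true) × ¬ W ∋ u
  meeting⁻ {W} (dominating inside dominates) = dominating inside′ dominates′ , u∉W
    where
    u∉W : ¬ W ∋ u
    u∉W u∈W = proj₂ (contract-V⁻ G u (inside u∈W)) refl
    inside′ : ∀ {w} → (W [ u ]≔ true) ∋ w → V G ∋ w
    inside′ = insert-inside W (λ w∈W → proj₁ (contract-V⁻ G u (inside w∈W)))
    dominates′ : ∀ {v} → V G ∋ v → DominatedBy G (W [ u ]≔ true) v
    dominates′ {v} v∈V with v ≟ u
    ... | yes refl = member (insert-∋-new W u)
    ... | no v≢u with dominates (contract-V⁺ G u v∈V v≢u)
    ...   | member v∈W = member (insert-∋-old W u v∈W)
    ...   | neighbour w w∈W a with proj₁ (contract-adj⁻ G u a)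
    ...     | inj₁ a′ = neighbour w (insert-∋-old W u w∈W) a′
    ...     | inj₂ (_ , uv) = neighbour u (insert-∋-new W u) uv

  -- (4) For W with W ∩ N(u) = ∅: W dominates G / u iff it dominates G - u, as
  -- the two graphs share their vertex set and the edges leaving W.
  contract⇒deleteV : ∀ {W} → Avoids G u W → Dominating (contract G u) W → Dominating (deleteV G u) W
  contract⇒deleteV {W} avoids = dominating-transfer
    (λ i∈V′ → let i∈V , i≢u = contract-V⁻ G u i∈V′ in deleteV-V⁺ G u i∈V i≢u)
    (λ i∈V′ → let i∈V , i≢u = deleteV-V⁻ G u i∈V′ in contract-V⁺ G u i∈V i≢u)
    edge
    where
    edge : ∀ {w v} → W ∋ w → Adj (contract G u) w v → Adj (deleteV G u) w v
    edge w∈W a with contract-adj⁻ G u a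
    ... | inj₁ a′ , w≢u , v≢u = deleteV-adj⁺ G u a′ w≢u v≢u
    ... | inj₂ (uw , _) , _ = ⊥-elim (avoids w∈W uw)

  deleteV⇒contract : ∀ {W} → Dominating (deleteV G u) W → Dominating (contract G u) W
  deleteV⇒contract = dominating-transfer
    (λ i∈V′ → let i∈V , i≢u = deleteV-V⁻ G u i∈V′ in contract-V⁺ G u i∈V i≢u)
    (λ i∈V′ → let i∈V , i≢u = contract-V⁻ G u i∈V′ in deleteV-V⁺ G u i∈V i≢u)
    (λ _ a → let a′ , w≢u , v≢u = deleteV-adj⁻ G u a in contract-adj⁺ G u (inj₁ a′) w≢u v≢u)

  count-without-u : IsSimple G → ∀ W →
    isDom G W ∧ not (lookup W u) ≡ isDom (deleteV G u) W ∧ not (avoidsN G u W)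
  count-without-u simple W = T-ext to from
    where
    to : T (isDom G W ∧ not (lookup W u)) → T (isDom (deleteV G u) W ∧ not (avoidsN G u W))
    to t = let d , u∉W = T-∧-not⁻ _ _ t
               d′ , meets = without-u⁺ simple (isDom⁻ G W d) u∉W
           in T-∧-not⁺ _ _ (isDom⁺ _ W d′) (meets⇒¬avoidsN G u W meets)
    from : T (isDom (deleteV G u) W ∧ not (avoidsN G u W)) → T (isDom G W ∧ not (lookup W u))
    from t = let d′ , ¬avoids = T-∧-not⁻ _ _ t
                 d , u∉W = without-u⁻ simple (isDom⁻ _ W d′) (¬avoidsN⇒meets G u W ¬avoids)
             in T-∧-not⁺ _ _ (isDom⁺ G W d) u∉W

  count-avoiding : ∀ W →
    (isDom G (W [ u ]≔ true) ∧ not (lookup W u)) ∧ avoidsN G u W ≡ isDom (deleteN G u) W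
  count-avoiding W = T-ext to from
    where
    to : T ((isDom G (W [ u ]≔ true) ∧ not (lookup W u)) ∧ avoidsN G u W) → T (isDom (deleteN G u) W)
    to t = let d-u∉W , avoids = Equivalence.to (T-∧ {isDom G (W [ u ]≔ true) ∧ _}) t
               d , u∉W = T-∧-not⁻ _ _ d-u∉W
           in isDom⁺ _ W (avoiding⁺ (isDom⁻ G _ d) u∉W (avoidsN⁻ G u W avoids))
    from : T (isDom (deleteN G u) W) → T ((isDom G (W [ u ]≔ true) ∧ not (lookup W u)) ∧ avoidsN G u W)
    from t = let d , u∉W , avoids = avoiding⁻ (isDom⁻ _ W t) in
      Equivalence.from T-∧ (T-∧-not⁺ _ _ (isDom⁺ G _ d) u∉W , avoidsN⁺ G u W avoids)

  count-meeting : ∀ W →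
    (isDom G (W [ u ]≔ true) ∧ not (lookup W u)) ∧ not (avoidsN G u W)
      ≡ isDom (contract G u) W ∧ not (avoidsN G u W)
  count-meeting W = ∧-guard (not (avoidsN G u W)) λ ¬avoids →
    let meets = ¬avoidsN⇒meets G u W (T-not⁻ _ ¬avoids) in
    T-ext (λ t → let d , u∉W = T-∧-not⁻ _ _ t in isDom⁺ _ W (meeting⁺ meets (isDom⁻ G _ d) u∉W))
          (λ t → let d , u∉W = meeting⁻ (isDom⁻ _ W t) in T-∧-not⁺ _ _ (isDom⁺ G _ d) u∉W)

  count-contract-avoiding : ∀ W →
    isDom (contract G u) W ∧ avoidsN G u W ≡ isDom (deleteV G u) W ∧ avoidsN G u W
  count-contract-avoiding W = ∧-guard (avoidsN G u W) λ t-avoids →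
    T-ext (λ t → isDom⁺ _ W (contract⇒deleteV (avoidsN⁻ G u W t-avoids) (isDom⁻ _ W t)))
          (λ t → isDom⁺ _ W (deleteV⇒contract (isDom⁻ _ W t)))

module Summation {c ℓ : Level} (R : CommutativeRing c ℓ) (x : CommutativeRing.Carrier R) where
  open CommutativeRing R hiding (refl; sym; trans; zero)
  module R = CommutativeRing R
  open import Relation.Binary.Reasoning.Setoid setoid
  open import Algebra.Properties.CommutativeSemigroup +-commutativeSemigroup using (x∙yz≈y∙xz)

  ∑ : ∀ {n} → (Sub n → Bool) → Carrier
  ∑ P = sumSubs R P x

  sumOver : ∀ {n} → (Sub n → Bool) → Carrier → List (Sub n) → Carrier
  sumOver P a = foldr (λ W acc → if P W then pow R x (size W) + acc else acc) a

  sumOver-cong : ∀ {n} {P Q : Sub n → Bool} → (∀ W → P W ≡ Q W) → ∀ a L → sumOver P a L ≡ sumOver Q a L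
  sumOver-cong eq a [] = refl
  sumOver-cong {P = P} {Q} eq a (W ∷ L) rewrite eq W | sumOver-cong eq a L = refl

  sumOver-nothing : ∀ {n} a (L : List (Sub n)) → sumOver (λ _ → false) a L ≡ a
  sumOver-nothing a [] = refl
  sumOver-nothing a (W ∷ L) = sumOver-nothing a L

  sumOver-start : ∀ {n} (P : Sub n → Bool) a L → sumOver P a L ≈ sumOver P 0# L + a
  sumOver-start P a [] = R.sym (+-identityˡ a)
  sumOver-start P a (W ∷ L) with P W
  ... | true = R.trans (+-congˡ (sumOver-start P a L)) (R.sym (+-assoc _ _ _))
  ... | false = sumOver-start P a L

  sumOver-true∷ : ∀ {n} (P : Sub (suc n) → Bool) L →
    sumOver P 0# (map (true ∷_) L) ≈ x * sumOver (λ W → P (true ∷ W)) 0# L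
  sumOver-true∷ P [] = R.sym (zeroʳ x)
  sumOver-true∷ P (W ∷ L) with P (true ∷ W)
  ... | true = R.trans (+-congˡ (sumOver-true∷ P L)) (R.sym (distribˡ x _ _))
  ... | false = sumOver-true∷ P L

  ∑-suc : ∀ {n} (P : Sub (suc n) → Bool) → ∑ P ≈ ∑ (λ W → P (false ∷ W)) + x * ∑ (λ W → P (true ∷ W))
  ∑-suc {n} P = begin
    sumOver P 0# (map (false ∷_) Ws ++ map (true ∷_) Ws)                 ≡⟨ foldr-++ _ 0# (map (false ∷_) Ws) _ ⟩
    sumOver P (sumOver P 0# (map (true ∷_) Ws)) (map (false ∷_) Ws)      ≡⟨ foldr-map _ (false ∷_) _ Ws ⟩
    sumOver (λ W → P (false ∷ W)) (sumOver P 0# (map (true ∷_) Ws)) Ws  ≈⟨ sumOver-start _ _ Ws ⟩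
    ∑ (λ W → P (false ∷ W)) + sumOver P 0# (map (true ∷_) Ws)           ≈⟨ +-congˡ (sumOver-true∷ P Ws) ⟩
    ∑ (λ W → P (false ∷ W)) + x * ∑ (λ W → P (true ∷ W))                ∎
    where
    Ws = allSubs n

  ∑-cong : ∀ {n} {P Q : Sub n → Bool} → (∀ W → P W ≡ Q W) → ∑ P ≡ ∑ Q
  ∑-cong {n} eq = sumOver-cong eq 0# (allSubs n)

  ∑-nothing : ∀ {n} {P : Sub n → Bool} → (∀ W → P W ≡ false) → ∑ P ≈ 0#
  ∑-nothing {n} eq = R.reflexive (trans (∑-cong eq) (sumOver-nothing 0# (allSubs n)))

  ∑-split : ∀ {n} (P Q : Sub n → Bool) → ∑ P ≈ ∑ (λ W → P W ∧ Q W) + ∑ (λ W → P W ∧ not (Q W))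
  ∑-split P Q = split (allSubs _)
    where
    split : ∀ L → sumOver P 0# L ≈ sumOver (λ W → P W ∧ Q W) 0# L + sumOver (λ W → P W ∧ not (Q W)) 0# L
    split [] = R.sym (+-identityʳ 0#)
    split (W ∷ L) with P W | Q W
    ... | false | _ = split L
    ... | true | true = R.trans (+-congˡ (split L)) (R.sym (+-assoc _ _ _))
    ... | true | false = R.trans (+-congˡ (split L)) (x∙yz≈y∙xz _ _ _)

  -- W ↦ W ∪ {u} is a bijection from the subsets avoiding u to those containing
  -- u, and it raises the size by one.
  ∑-insert : ∀ {n} (u : Fin n) (P : Sub n → Bool) →
    ∑ (λ W → P W ∧ lookup W u) ≈ x * ∑ (λ W → P (W [ u ]≔ true) ∧ not (lookup W u))
  ∑-insert {suc n} zero P = begin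
    ∑ (λ W → P W ∧ lookup W zero)
      ≈⟨ ∑-suc (λ W → P W ∧ lookup W zero) ⟩
    ∑ (λ W → P (false ∷ W) ∧ false) + x * with-0
      ≈⟨ +-congʳ (∑-nothing (λ W → ∧-zeroʳ (P (false ∷ W)))) ⟩
    0# + x * with-0
      ≈⟨ +-identityˡ _ ⟩
    x * with-0
      ≈⟨ *-congˡ (R.sym (+-identityʳ with-0)) ⟩
    x * (with-0 + 0#)
      ≈⟨ *-congˡ (+-congˡ (R.sym (R.trans (*-congˡ (∑-nothing (λ W → ∧-zeroʳ (P (true ∷ W))))) (zeroʳ x)))) ⟩
    x * (with-0 + x * ∑ (λ W → P (true ∷ W) ∧ false))
      ≈⟨ *-congˡ (R.sym (∑-suc (λ W → P (W [ zero ]≔ true) ∧ not (lookup W zero)))) ⟩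
    x * ∑ (λ W → P (W [ zero ]≔ true) ∧ not (lookup W zero)) ∎
    where
    with-0 : Carrier
    with-0 = ∑ (λ W → P (true ∷ W) ∧ true)
  ∑-insert {suc n} (suc u) P = begin
    ∑ (λ W → P W ∧ lookup W (suc u))
      ≈⟨ ∑-suc (λ W → P W ∧ lookup W (suc u)) ⟩
    ∑ (λ W → P₀ W ∧ lookup W u) + x * ∑ (λ W → P₁ W ∧ lookup W u)
      ≈⟨ +-cong (∑-insert u P₀) (*-congˡ (∑-insert u P₁)) ⟩
    x * ∑ (λ W → P₀ (W [ u ]≔ true) ∧ not (lookup W u)) + x * (x * ∑ (λ W → P₁ (W [ u ]≔ true) ∧ not (lookup W u)))
      ≈⟨ R.sym (distribˡ x _ _) ⟩
    x * (∑ (λ W → P₀ (W [ u ]≔ true) ∧ not (lookup W u)) + x * ∑ (λ W → P₁ (W [ u ]≔ true) ∧ not (lookup W u)))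
      ≈⟨ *-congˡ (R.sym (∑-suc (λ W → P (W [ suc u ]≔ true) ∧ not (lookup W (suc u))))) ⟩
    x * ∑ (λ W → P (W [ suc u ]≔ true) ∧ not (lookup W (suc u))) ∎
    where
    P₀ P₁ : Sub n → Bool
    P₀ W = P (false ∷ W)
    P₁ W = P (true ∷ W)

module RingFacts {c ℓ : Level} (R : CommutativeRing c ℓ) where
  open CommutativeRing R hiding (refl; sym; trans; zero)
  module R = CommutativeRing R
  open import Relation.Binary.Reasoning.Setoid setoid
  open import Algebra.Properties.Ring ring using (-‿distribʳ-*)
  open import Algebra.Properties.AbelianGroup +-abelianGroup using (⁻¹-∙-comm; xyx⁻¹≈y)
  import Algebra.Solver.CommutativeMonoid as CMS
  module M = CMS +-commutativeMonoid

  solve-difference : ∀ a b c → a ≈ b + c → c ≈ a - b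
  solve-difference a b c eq = R.sym (R.trans (+-congʳ eq) (xyx⁻¹≈y b c))

  recurrence-algebra : ∀ x N C P B →
    (x * N + x * (C - P)) + (B - P) ≈ (x * C + B + x * N) - (1# + x) * P
  recurrence-algebra x N C P B = begin
    (x * N + x * (C - P)) + (B - P)
      ≈⟨ +-congʳ (+-congˡ (R.trans (distribˡ x C (- P)) (+-congˡ (R.sym (-‿distribʳ-* x P))))) ⟩
    (x * N + (x * C + - (x * P))) + (B + - P)
      ≈⟨ regroup (x * N) (x * C) (- (x * P)) B (- P) ⟩
    (x * C + B + x * N) + (- P + - (x * P))
      ≈⟨ +-congˡ (⁻¹-∙-comm P (x * P)) ⟩
    (x * C + B + x * N) - (P + x * P)
      ≈⟨ +-congˡ (-‿cong (R.trans (+-congʳ (R.sym (*-identityˡ P))) (R.sym (distribʳ P 1# x)))) ⟩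
    (x * C + B + x * N) - (1# + x) * P ∎
    where
    regroup : ∀ a b c d e → (a + (b + c)) + (d + e) ≈ ((b + d) + a) + (e + c)
    regroup = M.solve 5 (λ a b c d e → ((a M.⊕ (b M.⊕ c)) M.⊕ (d M.⊕ e)) M.⊜ (((b M.⊕ d) M.⊕ a) M.⊕ (e M.⊕ c))) R.refl

module Recurrence {c ℓ : Level} (R : CommutativeRing c ℓ) (x : CommutativeRing.Carrier R)
    {n : ℕ} (G : Graph n) (simple : IsSimple G) (u : Fin n) (u∈V : V G ∋ u) where
  open CommutativeRing R hiding (refl; sym; trans; zero)
  open import Relation.Binary.Reasoning.Setoid setoid
  open Summation R x
  open Correspondences G u u∈V

  contractMeeting : Carrier
  contractMeeting = ∑ (λ W → isDom (contract G u) W ∧ not (avoidsN G u W))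

  D-by-u : D R G x ≈ Din R G u x + Dout R G u x
  D-by-u = ∑-split (isDom G) (λ W → lookup W u)

  -- Dominating sets of G - u split into those avoiding N(u), counted by p_u,
  -- and those meeting N(u), which are the dominating sets of G avoiding u.
  deleteV-by-N : D R (deleteV G u) x ≈ p R G u x + Dout R G u x
  deleteV-by-N = begin
    D R (deleteV G u) x
      ≈⟨ ∑-split (isDom (deleteV G u)) (avoidsN G u) ⟩
    p R G u x + ∑ (λ W → isDom (deleteV G u) W ∧ not (avoidsN G u W))
      ≡⟨ cong (p R G u x +_) (∑-cong (λ W → sym (count-without-u simple W))) ⟩
    p R G u x + Dout R G u x ∎

  -- Dominating sets of G / u avoiding N(u) are those of G - u.
  contract-by-N : D R (contract G u) x ≈ p R G u x + contractMeeting
  contract-by-N = begin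
    D R (contract G u) x
      ≈⟨ ∑-split (isDom (contract G u)) (avoidsN G u) ⟩
    ∑ (λ W → isDom (contract G u) W ∧ avoidsN G u W) + contractMeeting
      ≡⟨ cong (_+ contractMeeting) (∑-cong count-contract-avoiding) ⟩
    p R G u x + contractMeeting ∎

  -- A dominating set containing u is W ∪ {u} with u ∉ W, and W then dominates
  -- G - N[u] or G / u according as it avoids or meets N(u).
  Din-by-N : Din R G u x ≈ x * (D R (deleteN G u) x + contractMeeting)
  Din-by-N = begin
    Din R G u x
      ≈⟨ ∑-insert u (isDom G) ⟩
    x * ∑ withU
      ≈⟨ *-congˡ (∑-split withU (avoidsN G u)) ⟩
    x * (∑ (λ W → withU W ∧ avoidsN G u W) + ∑ (λ W → withU W ∧ not (avoidsN G u W)))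
      ≡⟨ cong₂ (λ a b → x * (a + b)) (∑-cong count-avoiding) (∑-cong count-meeting) ⟩
    x * (D R (deleteN G u) x + contractMeeting) ∎
    where
    withU : Sub n → Bool
    withU W = isDom G (W [ u ]≔ true) ∧ not (lookup W u)

mainTheorem1 : ∀ {c ℓ : Level} (R : CommutativeRing c ℓ) (x : CommutativeRing.Carrier R)
    {n : ℕ} (G : Graph n) → IsSimple G → (u : Fin n) → lookup (V G) u ≡ true →
    let open CommutativeRing R in
    (D R G x ≈ (x * D R (contract G u) x + D R (deleteV G u) x + x * D R (deleteN G u) x) - (1# + x) * p R G u x)
    × (Dout R G u x ≈ D R (deleteV G u) x - p R G u x)
    × (Din R G u x ≈ x * D R (deleteN G u) x + x * (D R (contract G u) x - p R G u x))
mainTheorem1 R x G simple u u∈V = D-formula , Dout-formula , Din-formula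
  where
  open CommutativeRing R hiding (refl; sym; trans; zero)
  open import Relation.Binary.Reasoning.Setoid setoid
  open RingFacts R
  open Recurrence R x G simple u (Equivalence.from T-≡ u∈V)

  B C N P : Carrier
  B = D R (deleteV G u) x
  C = D R (contract G u) x
  N = D R (deleteN G u) x
  P = p R G u x

  Dout-formula : Dout R G u x ≈ B - P
  Dout-formula = solve-difference B P _ deleteV-by-N

  Din-formula : Din R G u x ≈ x * N + x * (C - P)
  Din-formula = begin
    Din R G u x                   ≈⟨ Din-by-N ⟩
    x * (N + contractMeeting)     ≈⟨ distribˡ x N contractMeeting ⟩
    x * N + x * contractMeeting   ≈⟨ +-congˡ (*-congˡ (solve-difference C P _ contract-by-N)) ⟩
    x * N + x * (C - P)           ∎

  D-formula : D R G x ≈ (x * C + B + x * N) - (1# + x) * P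
  D-formula = begin
    D R G x                           ≈⟨ D-by-u ⟩
    Din R G u x + Dout R G u x        ≈⟨ +-cong Din-formula Dout-formula ⟩
    (x * N + x * (C - P)) + (B - P)   ≈⟨ recurrence-algebra x N C P B ⟩
    (x * C + B + x * N) - (1# + x) * P ∎
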